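{- $$\mathrm{toi}(K_t \square K_s) = \begin{cases} t+s-1 &\text{ if } t, s\geq 2 \text{ and } \max\{s,t\} \geq 4\\ 4 &\text{ if } s=t=3\\ 3 &\text{ if } s=3 \text{ and } t=2 \end{cases}$$
   Context: $\mathrm{toi}(G)$ is the maximum $t$ such that $G$ contains a totally odd strong immersion of $K_t$ (pairwise edge-disjoint odd paths joining all pairs of $t$ terminal vertices, with no terminal appearing as an interior vertex of a path). $G\square H$ denotes the Cartesian product: vertex set $V(G)\times V(H)$, with $(g_1,h_1)(g_2,h_2)$ an edge if $g_1=g_2$ and $h_1h_2\in E(H)$, or $h_1=h_2$ and $g_1g_2\in E(G)$. -}

module Defs where

open import Level using (Level; suc; _⊔_)
open import Data.Nat using (ℕ; _+_; _∸_; _≤_; _<_; _%_)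
open import Data.Fin using (Fin) renaming (_<_ to _<ᶠ_)
open import Data.Product using (_×_; _,_; Σ; ∃-syntax)
open import Data.Sum using (_⊎_)
open import Data.Unit using (⊤)
open import Data.Empty using (⊥)
open import Data.List using (List; []; _∷_; _++_; [_]; length)
open import Data.List.Relation.Unary.All using (All)
open import Data.List.Relation.Unary.Unique.Propositional using (Unique)
open import Data.List.Membership.Propositional using (_∈_)
open import Relation.Binary.PropositionalEquality using (_≡_; _≢_)
open import Function.Definitions using (Injective)

record Graph : Set₁ where
  field
    V     : Set
    Adj   : V → V → Set
    sym   : ∀ {u v} → Adj u v → Adj v u
    irrefl : ∀ {v} → Adj v v → ⊥
open Graph public

K : ℕ → Graph
K t = record
  { V = Fin t
  ; Adj = λ a b → a ≢ b
  ; sym = λ p q → p (Relation.Binary.PropositionalEquality.sym q)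
  ; irrefl = λ p → p Relation.Binary.PropositionalEquality.refl
  }

_□_ : Graph → Graph → Graph
G □ H = record
  { V = V G × V H
  ; Adj = λ { (g₁ , h₁) (g₂ , h₂) →
        (g₁ ≡ g₂ × Adj H h₁ h₂) ⊎ (h₁ ≡ h₂ × Adj G g₁ g₂) }
  ; sym = λ { (Data.Sum.inj₁ (e , a)) → Data.Sum.inj₁ (Relation.Binary.PropositionalEquality.sym e , Graph.sym H a)
            ; (Data.Sum.inj₂ (e , a)) → Data.Sum.inj₂ (Relation.Binary.PropositionalEquality.sym e , Graph.sym G a) }
  ; irrefl = λ { (Data.Sum.inj₁ (_ , a)) → Graph.irrefl H a
               ; (Data.Sum.inj₂ (_ , a)) → Graph.irrefl G a }
  }

Consecutive : {A : Set} → (A → A → Set) → List A → Set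
Consecutive R []            = ⊤
Consecutive R (x ∷ [])      = ⊤
Consecutive R (x ∷ y ∷ xs)  = R x y × Consecutive R (y ∷ xs)

steps : {A : Set} → List A → List (A × A)
steps []           = []
steps (x ∷ [])     = []
steps (x ∷ y ∷ xs) = (x , y) ∷ steps (y ∷ xs)

EdgeDisjoint : {A : Set} → List A → List A → Set
EdgeDisjoint P Q = ∀ a b → (a , b) ∈ steps P → ((a , b) ∈ steps Q → ⊥) × ((b , a) ∈ steps Q → ⊥)

record TOImmersion (G : Graph) (r : ℕ) : Set where
  field
    term     : Fin r → V G
    term-inj : Injective _≡_ _≡_ term
    interior : Fin r → Fin r → List (V G)
  path : Fin r → Fin r → List (V G)
  path i j = term i ∷ (interior i j ++ [ term j ])
  field
    isPath   : ∀ i j → i <ᶠ j → Unique (path i j) × Consecutive (Adj G) (path i j)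
    odd      : ∀ i j → i <ᶠ j → (length (path i j) ∸ 1) % 2 ≡ 1
    noTerm   : ∀ i j → i <ᶠ j → All (λ v → ∀ k → v ≢ term k) (interior i j)
    disjoint : ∀ i j k l → i <ᶠ j → k <ᶠ l → (i ≡ k × j ≡ l → ⊥) →
               EdgeDisjoint (path i j) (path k l)

toi≡ : Graph → ℕ → Set
toi≡ G n = TOImmersion G n × (∀ m → TOImmersion G m → m ≤ n)

{-# OPTIONS --safe #-}
module Submission where

-- The m − 1 walks leaving a terminal start along distinct edges, so m ≤ Δ + 1 = t + s − 1. For max(t, s) ≥ 4 the
-- bound is attained with row 0 and column 0 as terminals: (a, 0) and (0, b), a, b ≠ 0, are joined through
-- (a, b⁺) and (a, b), where b ↦ b⁺ is a cyclic shift of the at least three nonzero columns, so that no two of these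
-- detours share an edge.
-- If m = Δ + 1, every edge at a terminal begins one of its walks. A walk entering a non-terminal w from a terminal
-- then continues to another non-terminal, and walks from different terminals leave w along different edges, so at
-- most half of the neighbours of w are terminals. Checking all 4-subsets of K₂ □ K₃ and 5-subsets of K₃ □ K₃ leaves
-- only a row plus a column in K₃ □ K₃. There the walks from the two terminal neighbours of each remaining vertex
-- both turn or both go straight, and a case analysis on the four remaining vertices always produces a detour
-- between adjacent terminals, a walk from a terminal back to itself, or two walks for the same pair.

open import Defs
open import Data.Nat using (ℕ; _+_; _∸_; _≤_; _⊔_)
open import Data.Product using (_×_)
open import Relation.Binary.PropositionalEquality using (_≡_)

open import Data.Nat using (zero; suc; z≤n; s≤s; _%_)
import Data.Nat.Properties as ℕ
open import Data.Fin as Fin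
  using (Fin; zero; suc; toℕ; fromℕ; inject₁; punchIn; punchOut; splitAt; join; opposite)
import Data.Fin.Properties as Fin
open import Data.Fin.Patterns using (0F; 1F; 2F; 3F)
import Data.Fin.Relation.Unary.Top as Top
open import Data.Product as Product using (∃; ∃₂; _,_; proj₁; proj₂)
open import Data.Product.Properties using (≡-dec)
open import Data.Sum as Sum using (_⊎_; inj₁; inj₂)
import Data.Sum.Properties as Sumₚ
open import Data.Maybe using (fromMaybe)
open import Data.Bool using (true; false)
open import Data.Empty using (⊥; ⊥-elim)
open import Data.Unit using (⊤)
open import Data.List
  using (List; []; _∷_; _++_; [_]; length; reverse; map; filter; tabulate; lookup; allFin; cartesianProduct; head)
import Data.List.Properties as List
open import Data.List.Relation.Unary.All as All using (All; []; _∷_)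
import Data.List.Relation.Unary.All.Properties as Allₚ
open import Data.List.Relation.Unary.Any as Any using (Any; here; there)
import Data.List.Relation.Unary.Any.Properties as Anyₚ
open import Data.List.Relation.Unary.AllPairs using ([]; _∷_)
open import Data.List.Relation.Unary.Unique.Propositional using (Unique)
import Data.List.Relation.Unary.Unique.Propositional.Properties as Unique
open import Data.List.Membership.Propositional using (_∈_; _∉_)
import Data.List.Membership.Propositional.Properties as ∈
open import Data.List.Membership.DecPropositional using () renaming (_∈?_ to member?)
open import Relation.Binary.PropositionalEquality as ≡ using (refl; trans; cong; cong₂; subst; subst₂; _≢_)
open import Relation.Binary.Definitions using (DecidableEquality; tri<; tri≈; tri>)
open import Relation.Nullary using (¬_; Dec; yes; no; does; _×-dec_; _⊎-dec_; _→-dec_; ¬?)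
open import Relation.Nullary.Decidable using (True; toWitness; from-yes; from-no)
open import Relation.Unary using (Decidable)
open import Function using (_∘_)
open import Function.Definitions using (Injective)

module _ {A : Set} where

  data Step (a b : A) : List A → Set where
    here  : ∀ {xs} → Step a b (a ∷ b ∷ xs)
    there : ∀ {x xs} → Step a b xs → Step a b (x ∷ xs)

  Edge : A → A → List A → Set
  Edge a b xs = Step a b xs ⊎ Step b a xs

  Step⇒∈steps : ∀ {a b xs} → Step a b xs → (a , b) ∈ steps xs
  Step⇒∈steps here = here refl
  Step⇒∈steps (there {xs = _ ∷ _} s) = there (Step⇒∈steps s)

  ∈steps⇒Step : ∀ {a b} xs → (a , b) ∈ steps xs → Step a b xs
  ∈steps⇒Step (_ ∷ _ ∷ _) (here refl) = here
  ∈steps⇒Step (_ ∷ y ∷ xs) (there p) = there (∈steps⇒Step (y ∷ xs) p)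

  Step-++⁺ˡ : ∀ {a b xs} ys → Step a b xs → Step a b (xs ++ ys)
  Step-++⁺ˡ ys here = here
  Step-++⁺ˡ ys (there s) = there (Step-++⁺ˡ ys s)

  Step-∷ʳ-∷ʳ : ∀ {a b} xs → Step a b ((xs ++ [ a ]) ++ [ b ])
  Step-∷ʳ-∷ʳ [] = here
  Step-∷ʳ-∷ʳ (x ∷ xs) = there (Step-∷ʳ-∷ʳ xs)

  Step-reverse : ∀ {a b xs} → Step a b xs → Step b a (reverse xs)
  Step-reverse {a} {b} (here {xs}) rewrite List.unfold-reverse a (b ∷ xs) | List.unfold-reverse b xs =
    Step-∷ʳ-∷ʳ (reverse xs)
  Step-reverse (there {x} {xs} s) rewrite List.unfold-reverse x xs = Step-++⁺ˡ [ x ] (Step-reverse s)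

  Edge-reverse : ∀ {a b xs} → Edge a b xs → Edge a b (reverse xs)
  Edge-reverse (inj₁ s) = inj₂ (Step-reverse s)
  Edge-reverse (inj₂ s) = inj₁ (Step-reverse s)

  Consecutive-lookup : ∀ {R : A → A → Set} {a b xs} → Consecutive R xs → Step a b xs → R a b
  Consecutive-lookup (r , _) here = r
  Consecutive-lookup {xs = _ ∷ _ ∷ _} (_ , c) (there s) = Consecutive-lookup c s

  Consecutive-tabulate : ∀ {R : A → A → Set} xs → (∀ {a b} → Step a b xs → R a b) → Consecutive R xs
  Consecutive-tabulate [] r = _
  Consecutive-tabulate (x ∷ []) r = _
  Consecutive-tabulate (x ∷ y ∷ xs) r = r here , Consecutive-tabulate (y ∷ xs) (r ∘ there)

  Consecutive-reverse : ∀ {R : A → A → Set} → (∀ {a b} → R a b → R b a) →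
                        ∀ {xs} → Consecutive R xs → Consecutive R (reverse xs)
  Consecutive-reverse R-sym {xs} c = Consecutive-tabulate (reverse xs) λ s →
    R-sym (Consecutive-lookup c (subst (Step _ _) (List.reverse-involutive xs) (Step-reverse s)))

  All-reverse : ∀ {P : A → Set} {xs} → All P xs → All P (reverse xs)
  All-reverse ps = All.tabulate (All.lookup ps ∘ Anyₚ.reverse⁻)

  Unique-reverse : ∀ {xs : List A} → Unique xs → Unique (reverse xs)
  Unique-reverse [] = []
  Unique-reverse {x ∷ xs} (x∉ ∷ u) rewrite List.unfold-reverse x xs =
    Unique.++⁺ (Unique-reverse u) ([] ∷ []) λ
      { (v∈ , here refl) → All.lookup x∉ (Anyₚ.reverse⁻ v∈) refl }

  ∉-++-∷ : ∀ {x : A} {xs ys zs} → x ∉ xs → xs ++ x ∷ ys ≡ x ∷ zs → xs ≡ []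
  ∉-++-∷ {xs = []} _ _ = refl
  ∉-++-∷ {xs = _ ∷ _} x∉ refl = ⊥-elim (x∉ (here refl))

  ∉-++⁻ˡ : ∀ {x : A} xs {ys} → x ∉ xs ++ ys → x ∉ xs
  ∉-++⁻ˡ xs x∉ = x∉ ∘ Anyₚ.++⁺ˡ

  reverse-∷≢[] : ∀ {x : A} {xs} → reverse (x ∷ xs) ≢ []
  reverse-∷≢[] {x} {xs} e with List.reverse-injective {x = x ∷ xs} {y = []} e
  ... | ()

  reverse-∷-∷ʳ : ∀ (u : A) xs v → reverse (u ∷ xs ++ [ v ]) ≡ v ∷ reverse xs ++ [ u ]
  reverse-∷-∷ʳ u xs v = trans (List.unfold-reverse u (xs ++ [ v ])) (cong (_++ [ u ]) (List.reverse-++ xs [ v ]))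

  Step-head : ∀ u xs v → Step u (fromMaybe v (head xs)) (u ∷ xs ++ [ v ])
  Step-head u [] v = here
  Step-head u (_ ∷ _) v = here

  lookup-injective : ∀ {xs : List A} → Unique xs → Injective _≡_ _≡_ (lookup xs)
  lookup-injective (_ ∷ _) {zero} {zero} _ = refl
  lookup-injective (x∉ ∷ _) {zero} {suc j} e = ⊥-elim (All.lookup x∉ (∈.∈-lookup j) e)
  lookup-injective (x∉ ∷ _) {suc i} {zero} e = ⊥-elim (All.lookup x∉ (∈.∈-lookup i) (≡.sym e))
  lookup-injective (_ ∷ u) {suc i} {suc j} e = cong suc (lookup-injective u e)

  sublists : List A → List (List A)
  sublists [] = [ [] ]
  sublists (x ∷ xs) = map (x ∷_) (sublists xs) ++ sublists xs

  filter∈sublists : ∀ {P : A → Set} (P? : Decidable P) xs → filter P? xs ∈ sublists xs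
  filter∈sublists P? [] = here refl
  filter∈sublists P? (x ∷ xs) with does (P? x)
  ... | true  = Anyₚ.++⁺ˡ (∈.∈-map⁺ (x ∷_) (filter∈sublists P? xs))
  ... | false = Anyₚ.++⁺ʳ _ (filter∈sublists P? xs)

  length-filter-image : ∀ {n} (_≟_ : DecidableEquality A) (f : Fin n → A) → Injective _≡_ _≡_ f →
                        ∀ {xs} → Unique xs → (∀ a → a ∈ xs) →
                        length (filter (λ a → Fin.any? (λ k → f k ≟ a)) xs) ≡ n
  length-filter-image _≟_ f f-inj {xs} xs-unique xs-complete =
    ≡.sym (Fin.cantor-schröder-bernstein {f = position} {g = preimage} position-injective preimage-injective)
    where
    image? = λ a → Fin.any? (λ k → f k ≟ a)
    image = filter image? xs
    position : _ → Fin (length image)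
    position k = Any.index (∈.∈-filter⁺ image? (xs-complete (f k)) (k , refl))
    position-injective : Injective _≡_ _≡_ position
    position-injective {k} {k′} e = f-inj (begin
      f k                        ≡⟨ lookup-position k ⟩
      lookup image (position k)  ≡⟨ cong (lookup image) e ⟩
      lookup image (position k′) ≡⟨ lookup-position k′ ⟨
      f k′                       ∎)
      where
      open ≡.≡-Reasoning
      lookup-position : ∀ k → f k ≡ lookup image (position k)
      lookup-position k = Anyₚ.lookup-index (∈.∈-filter⁺ image? (xs-complete (f k)) (k , refl))
    preimage-spec : ∀ l → ∃ λ k → f k ≡ lookup image l
    preimage-spec l = proj₂ (∈.∈-filter⁻ image? {xs = xs} (∈.∈-lookup l))
    preimage : Fin (length image) → _
    preimage l = proj₁ (preimage-spec l)
    preimage-injective : Injective _≡_ _≡_ preimage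
    preimage-injective {l} {l′} e = lookup-injective (Unique.filter⁺ image? xs-unique)
      (trans (≡.sym (proj₂ (preimage-spec l))) (trans (cong f e) (proj₂ (preimage-spec l′))))

module _ {A B : Set} (f : A → B) where

  steps-map : ∀ xs → steps (map f xs) ≡ map (Product.map f f) (steps xs)
  steps-map [] = refl
  steps-map (x ∷ []) = refl
  steps-map (x ∷ y ∷ xs) = cong ((f x , f y) ∷_) (steps-map (y ∷ xs))

  ∈steps-map⁻ : Injective _≡_ _≡_ f → ∀ {a b xs} → (f a , f b) ∈ steps (map f xs) → (a , b) ∈ steps xs
  ∈steps-map⁻ f-inj {a} {b} {xs} ab∈
    with ∈.∈-map⁻ (Product.map f f) (subst ((f a , f b) ∈_) (steps-map xs) ab∈)
  ... | _ , ab∈′ , e = subst (_∈ steps xs) (≡.sym (cong₂ _,_ (f-inj (cong proj₁ e)) (f-inj (cong proj₂ e)))) ab∈′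

  EdgeDisjoint-map : Injective _≡_ _≡_ f → ∀ {P Q} → EdgeDisjoint P Q → EdgeDisjoint (map f P) (map f Q)
  EdgeDisjoint-map f-inj {P} P⊥Q _ _ ab∈ with ∈.∈-map⁻ (Product.map f f) (subst (_ ∈_) (steps-map P) ab∈)
  ... | (a , b) , ab∈P , refl =
    proj₁ (P⊥Q a b ab∈P) ∘ ∈steps-map⁻ f-inj , proj₂ (P⊥Q a b ab∈P) ∘ ∈steps-map⁻ f-inj

  Consecutive-map : ∀ {R : A → A → Set} {S : B → B → Set} → (∀ {a b} → R a b → S (f a) (f b)) →
                    ∀ {xs} → Consecutive R xs → Consecutive S (map f xs)
  Consecutive-map h {[]} _ = _
  Consecutive-map h {_ ∷ []} _ = _
  Consecutive-map h {_ ∷ _ ∷ _} (r , c) = h r , Consecutive-map h c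

DegreeAtMost : Graph → ℕ → Set
DegreeAtMost G d = ∀ w (vs : List (V G)) → Unique vs → All (Adj G w) vs → length vs ≤ d

record Embedding (G H : Graph) : Set where
  field
    embed     : V G → V H
    injective : Injective _≡_ _≡_ embed
    adjacent  : ∀ {a b} → Adj G a b → Adj H (embed a) (embed b)

transport : ∀ {G H r} → Embedding G H → TOImmersion G r → TOImmersion H r
transport {G} {H} e Im = record
  { term     = embed ∘ term
  ; term-inj = term-inj ∘ injective
  ; interior = λ i j → map embed (interior i j)
  ; isPath   = λ i j i<j →
      subst Unique (path-map i j) (Unique.map⁺ injective (proj₁ (isPath i j i<j))) ,
      subst (Consecutive (Adj H)) (path-map i j) (Consecutive-map embed adjacent (proj₂ (isPath i j i<j)))
  ; odd      = λ i j i<j →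
      subst (λ n → (n ∸ 1) % 2 ≡ 1) (trans (≡.sym (List.length-map embed (path i j))) (cong length (path-map i j)))
            (odd i j i<j)
  ; noTerm   = λ i j i<j → Allₚ.map⁺ (All.map (λ ¬term k → ¬term k ∘ injective) (noTerm i j i<j))
  ; disjoint = λ i j k l i<j k<l ≢ → subst₂ EdgeDisjoint (path-map i j) (path-map k l)
                                       (EdgeDisjoint-map embed injective (disjoint i j k l i<j k<l ≢))
  }
  where
  open Embedding e
  open TOImmersion Im
  path-map : ∀ i j → map embed (path i j) ≡ embed (term i) ∷ map embed (interior i j) ++ [ embed (term j) ]
  path-map i j = cong (embed (term i) ∷_) (List.map-++ embed (interior i j) [ term j ])

_≐_ : ∀ {I : Set} → I × I → I × I → Set
p ≐ q = p ≡ q ⊎ p ≡ Product.swap q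

≐-common : ∀ {I : Set} {r : I × I} {p q} → r ≐ p → r ≐ q → p ≐ q
≐-common {p = _ , _} {_ , _} (inj₁ refl) (inj₁ refl) = inj₁ refl
≐-common {p = _ , _} {_ , _} (inj₁ refl) (inj₂ refl) = inj₂ refl
≐-common {p = _ , _} {_ , _} (inj₂ refl) (inj₁ refl) = inj₂ refl
≐-common {p = _ , _} {_ , _} (inj₂ refl) (inj₂ refl) = inj₁ refl

labelled-disjoint : ∀ {A I : Set} (label : A → A → I × I) {P Q : List A} {p q : I × I} →
                    (∀ {u v} → Step u v P → label u v ≐ p × label v u ≐ p) →
                    (∀ {u v} → Step u v Q → label u v ≐ q × label v u ≐ q) →
                    ¬ p ≐ q → EdgeDisjoint P Q
labelled-disjoint label {P} {Q} P-labels Q-labels p≭q a b ab∈P =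
  (λ ab∈Q → p≭q (≐-common (proj₁ (P-labels ab)) (proj₁ (Q-labels (∈steps⇒Step Q ab∈Q))))) ,
  (λ ba∈Q → p≭q (≐-common (proj₂ (P-labels ab)) (proj₁ (Q-labels (∈steps⇒Step Q ba∈Q)))))
  where
  ab = ∈steps⇒Step P ab∈P

module Immersion {G : Graph} {m : ℕ} (Im : TOImmersion G m) where
  open TOImmersion Im public

  IsTerminal NonTerminal : V G → Set
  IsTerminal v = ∃ λ k → term k ≡ v
  NonTerminal v = ∀ k → v ≢ term k

  record IsRoute (u : V G) (xs : List (V G)) (v : V G) : Set where
    field
      unique     : Unique (u ∷ xs ++ [ v ])
      linked     : Consecutive (Adj G) (u ∷ xs ++ [ v ])
      odd-length : length (xs ++ [ v ]) % 2 ≡ 1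
      internal   : All NonTerminal xs

  IsRoute-reverse : ∀ {u xs v} → IsRoute u xs v → IsRoute v (reverse xs) u
  IsRoute-reverse {u} {xs} {v} r = record
    { unique     = subst Unique (reverse-∷-∷ʳ u xs v) (Unique-reverse {xs = u ∷ xs ++ [ v ]} unique)
    ; linked     = subst (Consecutive (Adj G)) (reverse-∷-∷ʳ u xs v)
                     (Consecutive-reverse (Graph.sym G) {u ∷ xs ++ [ v ]} linked)
    ; odd-length = subst (λ n → n % 2 ≡ 1) same-length odd-length
    ; internal   = All-reverse internal
    }
    where
    open IsRoute r
    same-length : length (xs ++ [ v ]) ≡ length (reverse xs ++ [ u ])
    same-length = begin
      length (xs ++ [ v ])          ≡⟨ List.length-++ xs ⟩
      length xs + 1                 ≡⟨ cong (_+ 1) (List.length-reverse xs) ⟨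
      length (reverse xs) + 1       ≡⟨ List.length-++ (reverse xs) ⟨
      length (reverse xs ++ [ u ])  ∎
      where open ≡.≡-Reasoning

  path-route : ∀ {i j} → i Fin.< j → IsRoute (term i) (interior i j) (term j)
  path-route {i} {j} i<j = record
    { unique = proj₁ (isPath i j i<j) ; linked = proj₂ (isPath i j i<j)
    ; odd-length = odd i j i<j ; internal = noTerm i j i<j }

  between : Fin m → Fin m → List (V G)
  between i j with i Fin.<? j
  ... | yes _ = interior i j
  ... | no  _ = reverse (interior j i)

  walk : Fin m → Fin m → List (V G)
  walk i j = term i ∷ between i j ++ [ term j ]

  between-< : ∀ {i j} → i Fin.< j → between i j ≡ interior i j
  between-< {i} {j} i<j with i Fin.<? j
  ... | yes _   = refl
  ... | no  i≮j = ⊥-elim (i≮j i<j)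

  between-> : ∀ {i j} → j Fin.< i → between i j ≡ reverse (interior j i)
  between-> {i} {j} j<i with i Fin.<? j
  ... | yes i<j = ⊥-elim (Fin.<-asym i<j j<i)
  ... | no  _   = refl

  walk-route : ∀ {i j} → i ≢ j → IsRoute (term i) (between i j) (term j)
  walk-route {i} {j} i≢j with Fin.<-cmp i j
  ... | tri< i<j _ _ = subst (λ xs → IsRoute (term i) xs (term j)) (≡.sym (between-< i<j)) (path-route i<j)
  ... | tri≈ _ i≡j _ = ⊥-elim (i≢j i≡j)
  ... | tri> _ _ j<i =
    subst (λ xs → IsRoute (term i) xs (term j)) (≡.sym (between-> j<i)) (IsRoute-reverse (path-route j<i))

  between-sym : ∀ {i j} → i ≢ j → between j i ≡ reverse (between i j)
  between-sym {i} {j} i≢j with Fin.<-cmp i j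
  ... | tri< i<j _ _ = trans (between-> i<j) (cong reverse (≡.sym (between-< i<j)))
  ... | tri≈ _ i≡j _ = ⊥-elim (i≢j i≡j)
  ... | tri> _ _ j<i = trans (between-< j<i)
                         (trans (≡.sym (List.reverse-involutive _)) (cong reverse (≡.sym (between-> j<i))))

  path-edge-pair : ∀ {i j k l a b} → i Fin.< j → k Fin.< l →
                   Edge a b (path i j) → Edge a b (path k l) → (i , j) ≡ (k , l)
  path-edge-pair {i} {j} {k} {l} {a} {b} i<j k<l e e′ with ≡-dec Fin._≟_ Fin._≟_ (i , j) (k , l)
  ... | yes same = same
  ... | no different = ⊥-elim (shared e e′)
    where
    P⊥Q = disjoint i j k l i<j k<l (different ∘ Product.uncurry (cong₂ _,_))
    shared : Edge a b (path i j) → Edge a b (path k l) → ⊥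
    shared (inj₁ s) (inj₁ s′) = proj₁ (P⊥Q a b (Step⇒∈steps s)) (Step⇒∈steps s′)
    shared (inj₁ s) (inj₂ s′) = proj₂ (P⊥Q a b (Step⇒∈steps s)) (Step⇒∈steps s′)
    shared (inj₂ s) (inj₁ s′) = proj₂ (P⊥Q b a (Step⇒∈steps s)) (Step⇒∈steps s′)
    shared (inj₂ s) (inj₂ s′) = proj₁ (P⊥Q b a (Step⇒∈steps s)) (Step⇒∈steps s′)

  walk-edge : ∀ {i j a b} → i ≢ j → Edge a b (walk i j) →
              (i Fin.< j × Edge a b (path i j)) ⊎ (j Fin.< i × Edge a b (path j i))
  walk-edge {i} {j} i≢j e with Fin.<-cmp i j
  ... | tri< i<j _ _ = inj₁ (i<j , subst (λ xs → Edge _ _ (term i ∷ xs ++ [ term j ])) (between-< i<j) e)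
  ... | tri≈ _ i≡j _ = ⊥-elim (i≢j i≡j)
  ... | tri> _ _ j<i =
    inj₂ (j<i , subst (Edge _ _) (List.reverse-involutive (path j i)) (Edge-reverse (subst (Edge _ _) walk≡ e)))
    where
    walk≡ : walk i j ≡ reverse (path j i)
    walk≡ = trans (cong (λ xs → term i ∷ xs ++ [ term j ]) (between-> j<i))
                  (≡.sym (reverse-∷-∷ʳ (term j) (interior j i) (term i)))

  walk-edge-pair : ∀ {i j k l a b} → i ≢ j → k ≢ l →
                   Edge a b (walk i j) → Edge a b (walk k l) → (i , j) ≐ (k , l)
  walk-edge-pair i≢j k≢l e e′ with walk-edge i≢j e | walk-edge k≢l e′
  ... | inj₁ (i<j , p) | inj₁ (k<l , q) = inj₁ (path-edge-pair i<j k<l p q)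
  ... | inj₁ (i<j , p) | inj₂ (l<k , q) = inj₂ (path-edge-pair i<j l<k p q)
  ... | inj₂ (j<i , p) | inj₁ (k<l , q) = inj₂ (cong Product.swap (path-edge-pair j<i k<l p q))
  ... | inj₂ (j<i , p) | inj₂ (l<k , q) = inj₁ (cong Product.swap (path-edge-pair j<i l<k p q))

  first : Fin m → Fin m → V G
  first i j = fromMaybe (term j) (head (between i j))

  first-between : ∀ i j {xs} → between i j ≡ xs → first i j ≡ fromMaybe (term j) (head xs)
  first-between i j = cong (fromMaybe (term j) ∘ head)

  first-Step : ∀ i j → Step (term i) (first i j) (walk i j)
  first-Step i j = Step-head (term i) (between i j) (term j)

  first-adjacent : ∀ {i j} → i ≢ j → Adj G (term i) (first i j)
  first-adjacent {i} {j} i≢j = Consecutive-lookup (IsRoute.linked (walk-route i≢j)) (first-Step i j)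

  first-injective : ∀ {i j k} → i ≢ j → i ≢ k → first i j ≡ first i k → j ≡ k
  first-injective {i} {j} {k} i≢j i≢k e
    with walk-edge-pair i≢j i≢k (inj₁ (first-Step i j))
                                (inj₁ (subst (λ v → Step (term i) v (walk i k)) (≡.sym e) (first-Step i k)))
  ... | inj₁ e′ = cong proj₂ e′
  ... | inj₂ e′ = ⊥-elim (i≢k (cong proj₁ e′))

  record Departs (i : Fin m) (w y : V G) : Set where
    constructor departs
    field
      {target} : Fin m
      i≢target : i ≢ target
      {rest}   : List (V G)
      between≡ : between i target ≡ w ∷ y ∷ rest

  module _ {i w y} (d : Departs i w y) where
    open Departs d

    departs-Step : Step w y (walk i target)
    departs-Step = subst (λ xs → Step w y (term i ∷ xs ++ [ term target ])) (≡.sym between≡) (there here)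

    departs-adjacent : Adj G w y
    departs-adjacent = Consecutive-lookup (IsRoute.linked (walk-route i≢target)) departs-Step

    departs-unique-list : Unique (term i ∷ w ∷ y ∷ rest ++ [ term target ])
    departs-unique-list =
      subst (λ xs → Unique (term i ∷ xs ++ [ term target ])) between≡ (IsRoute.unique (walk-route i≢target))

    departs-w∉ : w ∉ y ∷ rest
    departs-w∉ with departs-unique-list
    ... | _ ∷ w∉ ∷ _ = ∉-++⁻ˡ (y ∷ rest) (λ m → All.lookup w∉ m refl)

    departs-y∉ : y ∉ rest
    departs-y∉ with departs-unique-list
    ... | _ ∷ _ ∷ y∉ ∷ _ = ∉-++⁻ˡ rest (λ m → All.lookup y∉ m refl)

  departs-unique : ∀ {i k w y} → Departs i w y → Departs k w y → i ≡ k
  departs-unique {i} {k} {w} {y} d@(departs {j} i≢j {R} e) d′@(departs {j′} k≢j′ e′)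
    with walk-edge-pair i≢j k≢j′ (inj₁ (departs-Step d)) (inj₁ (departs-Step d′))
  ... | inj₁ e″ = cong proj₁ e″
  -- Otherwise the two walks are reverses of each other, and w occurs twice on the walk from i.
  ... | inj₂ refl =
    ⊥-elim (reverse-∷≢[] {x = y} {xs = R} (∉-++-∷ {xs = reverse (y ∷ R)} (departs-w∉ d ∘ Anyₚ.reverse⁻) reversed))
    where
    reversed : reverse (y ∷ R) ++ w ∷ [] ≡ w ∷ y ∷ _
    reversed = trans (≡.sym (List.unfold-reverse w (y ∷ R)))
                 (trans (cong reverse (≡.sym e)) (trans (≡.sym (between-sym i≢j)) e′))

  departs-opposite : ∀ {i k w y} → Departs i w y → Departs k y w → i ≢ k × between i k ≡ w ∷ y ∷ []
  departs-opposite {i} {k} {w} {y} d@(departs {j} i≢j {R} e) d′@(departs {j′} k≢j′ e′)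
    with walk-edge-pair i≢j k≢j′ (inj₁ (departs-Step d)) (inj₂ (departs-Step d′))
  ... | inj₁ refl = ⊥-elim (Graph.irrefl G (subst (Adj G w) (≡.sym w≡y) (departs-adjacent d)))
    where
    w≡y : w ≡ y
    w≡y = List.∷-injectiveˡ (trans (≡.sym e) e′)
  ... | inj₂ refl = i≢j , trans e (cong (λ zs → w ∷ y ∷ zs) R≡[])
    where
    reversed : reverse R ++ y ∷ w ∷ [] ≡ y ∷ w ∷ _
    reversed = trans (≡.sym (List.reverse-++ (w ∷ y ∷ []) R))
                 (trans (cong reverse (≡.sym e)) (trans (≡.sym (between-sym i≢j)) e′))
    R≡[] : R ≡ []
    R≡[] = List.reverse-injective (∉-++-∷ {xs = reverse R} (departs-y∉ d ∘ Anyₚ.reverse⁻) reversed)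

  no-return : ∀ {i w y} → Departs i w y → Departs i y w → ⊥
  no-return d d′ = proj₁ (departs-opposite d d′) refl

immersion-size : ∀ {G d m} → DegreeAtMost G d → TOImmersion G m → m ≤ suc d
immersion-size {m = zero} _ _ = z≤n
immersion-size {G} {d} {suc m} degree Im = s≤s (subst (_≤ d) (List.length-tabulate firsts) bound)
  where
  open Immersion Im
  firsts : Fin m → V G
  firsts k = first zero (suc k)
  bound : length (tabulate firsts) ≤ d
  bound = degree (term zero) (tabulate firsts)
            (Unique.tabulate⁺ (Fin.suc-injective ∘ first-injective {zero} (λ ()) (λ ())))
            (Allₚ.tabulate⁺ (λ k → first-adjacent {zero} {suc k} (λ ())))

≢punchIn : ∀ {n} (i : Fin (suc n)) j → i ≢ punchIn i j
≢punchIn i j = Fin.punchInᵢ≢i i j ∘ ≡.sym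

module Saturated {G : Graph} {d : ℕ} (_≟_ : DecidableEquality (V G)) (degree : DegreeAtMost G d)
                 (Im : TOImmersion G (suc d)) where
  open Immersion Im public

  neighbour-is-first : ∀ {i w} → Adj G (term i) w → ∃ λ j → i ≢ j × first i j ≡ w
  neighbour-is-first {i} {w} a with Fin.any? (λ j → first i (punchIn i j) ≟ w)
  ... | yes (j , e) = punchIn i j , ≢punchIn i j , e
  ... | no ¬first   = ⊥-elim (ℕ.1+n≰n (subst (λ n → suc n ≤ d) (List.length-tabulate firsts) too-many))
    where
    firsts : Fin d → V G
    firsts = first i ∘ punchIn i
    too-many : length (w ∷ tabulate firsts) ≤ d
    too-many = degree (term i) (w ∷ tabulate firsts)
      (Allₚ.tabulate⁺ (λ j e → ¬first (j , ≡.sym e)) ∷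
         Unique.tabulate⁺ (λ e → Fin.punchIn-injective i _ _ (first-injective (≢punchIn i _) (≢punchIn i _) e)))
      (a ∷ Allₚ.tabulate⁺ (first-adjacent ∘ ≢punchIn i))

  departs-through : ∀ {i w} → Adj G (term i) w → NonTerminal w → ∃ λ y → Departs i w y × NonTerminal y
  departs-through {i} a w-nonterminal with neighbour-is-first a
  ... | j , i≢j , refl = continue (between i j) refl (walk-route i≢j)
    where
    continue : ∀ xs → between i j ≡ xs → IsRoute (term i) xs (term j) →
               ∃ λ y → Departs i (first i j) y × NonTerminal y
    continue [] e _ = ⊥-elim (w-nonterminal j (first-between i j e))
    continue (_ ∷ []) _ r with IsRoute.odd-length r
    ... | ()
    continue (x ∷ y ∷ R) e r =
      y , departs i≢j (trans e (cong (_∷ y ∷ R) (≡.sym (first-between i j e)))) ,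
      All.lookup (IsRoute.internal r) (there (here refl))

  adjacent-direct : ∀ {i j} → Adj G (term i) (term j) → between i j ≡ []
  adjacent-direct {i} {j} a with neighbour-is-first a
  ... | j′ , i≢j′ , first≡ = continue (between i j′) refl (walk-route i≢j′)
    where
    continue : ∀ xs → between i j′ ≡ xs → IsRoute (term i) xs (term j′) → between i j ≡ []
    continue [] e _ =
      subst (λ k → between i k ≡ []) (term-inj (trans (≡.sym (first-between i j′ e)) first≡)) e
    continue (x ∷ _) e r =
      ⊥-elim (All.lookup (IsRoute.internal r) (here refl) j (trans (≡.sym (first-between i j′ e)) first≡))

  no-detour : ∀ {i k w y} → Departs i w y → Departs k y w → Adj G (term i) (term k) → ⊥
  no-detour d d′ a with trans (≡.sym (proj₂ (departs-opposite d d′))) (adjacent-direct a)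
  ... | ()

  twice-terminal-neighbours-≤-degree : ∀ {w vs} → NonTerminal w → Unique vs →
                                       All (λ v → Adj G w v × IsTerminal v) vs → length vs + length vs ≤ d
  twice-terminal-neighbours-≤-degree {w} {vs} w-nonterminal vs-unique vs-terminal =
    subst (_≤ d) counted (degree w (vs ++ tabulate next-vertex) unique adjacent)
    where
    terminal : ∀ l → Adj G w (lookup vs l) × IsTerminal (lookup vs l)
    terminal l = All.lookup vs-terminal (∈.∈-lookup l)
    index : Fin (length vs) → Fin (suc d)
    index l = proj₁ (proj₂ (terminal l))
    term-index : ∀ l → term (index l) ≡ lookup vs l
    term-index l = proj₂ (proj₂ (terminal l))
    continuation : ∀ l → ∃ λ y → Departs (index l) w y × NonTerminal y
    continuation l =
      departs-through (subst (λ v → Adj G v w) (≡.sym (term-index l)) (Graph.sym G (proj₁ (terminal l)))) w-nonterminal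
    next-vertex : Fin (length vs) → V G
    next-vertex = proj₁ ∘ continuation
    departure : ∀ l → Departs (index l) w (next-vertex l)
    departure = proj₁ ∘ proj₂ ∘ continuation
    next-vertex-injective : Injective _≡_ _≡_ next-vertex
    next-vertex-injective {l} {l′} e = lookup-injective vs-unique
      (trans (≡.sym (term-index l)) (trans (cong term same-index) (term-index l′)))
      where
      same-index = departs-unique (departure l) (subst (Departs _ w) (≡.sym e) (departure l′))
    unique : Unique (vs ++ tabulate next-vertex)
    unique = Unique.++⁺ vs-unique (Unique.tabulate⁺ next-vertex-injective) λ (v∈vs , v∈next) →
      let (k , term-k≡v) = proj₂ (All.lookup vs-terminal v∈vs)
          (l , v≡next) = ∈.∈-tabulate⁻ v∈next
      in proj₂ (proj₂ (continuation l)) k (trans (≡.sym v≡next) (≡.sym term-k≡v))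
    adjacent : All (Adj G w) (vs ++ tabulate next-vertex)
    adjacent = Allₚ.++⁺ (All.map proj₁ vs-terminal) (Allₚ.tabulate⁺ (departs-adjacent ∘ departure))
    counted : length (vs ++ tabulate next-vertex) ≡ length vs + length vs
    counted = trans (List.length-++ vs) (cong (length vs +_) (List.length-tabulate next-vertex))

module _ {t s : ℕ} where

  _≟ᵛ_ : DecidableEquality (Fin t × Fin s)
  _≟ᵛ_ = ≡-dec Fin._≟_ Fin._≟_

  adjacent? : ∀ v w → Dec (Adj (K t □ K s) v w)
  adjacent? (a , b) (a′ , b′) =
    (a Fin.≟ a′ ×-dec ¬? (b Fin.≟ b′)) ⊎-dec (b Fin.≟ b′ ×-dec ¬? (a Fin.≟ a′))

  vertices : List (Fin t × Fin s)
  vertices = cartesianProduct (allFin t) (allFin s)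

  ∈-vertices : ∀ v → v ∈ vertices
  ∈-vertices (a , b) = ∈.∈-cartesianProduct⁺ (∈.∈-allFin a) (∈.∈-allFin b)

  vertices-unique : Unique vertices
  vertices-unique = Unique.cartesianProduct⁺ (Unique.allFin⁺ t) (Unique.allFin⁺ s)

module _ {t s : ℕ} where

  line-code : ∀ {w v} → Adj (K (suc t) □ K (suc s)) w v → Fin t ⊎ Fin s
  line-code (inj₁ (_ , b≢b′)) = inj₂ (punchOut b≢b′)
  line-code (inj₂ (_ , a≢a′)) = inj₁ (punchOut a≢a′)

  line-code-injective : ∀ {w v v′} (p : Adj (K (suc t) □ K (suc s)) w v) (q : Adj (K (suc t) □ K (suc s)) w v′) →
                        line-code p ≡ line-code q → v ≡ v′
  line-code-injective (inj₁ (refl , b≢)) (inj₁ (refl , b≢′)) e =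
    cong (_ ,_) (Fin.punchOut-injective b≢ b≢′ (Sumₚ.inj₂-injective e))
  line-code-injective (inj₂ (refl , a≢)) (inj₂ (refl , a≢′)) e =
    cong (_, _) (Fin.punchOut-injective a≢ a≢′ (Sumₚ.inj₁-injective e))
  line-code-injective (inj₁ _) (inj₂ _) ()
  line-code-injective (inj₂ _) (inj₁ _) ()

  rook-degree : DegreeAtMost (K (suc t) □ K (suc s)) (t + s)
  rook-degree w vs vs-unique adjacent = Fin.injective⇒≤ {f = code} code-injective
    where
    adjacency : ∀ l → Adj (K (suc t) □ K (suc s)) w (lookup vs l)
    adjacency l = All.lookup adjacent (∈.∈-lookup l)
    code : Fin (length vs) → Fin (t + s)
    code l = join t s (line-code (adjacency l))
    code-injective : Injective _≡_ _≡_ code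
    code-injective {l} {l′} e = lookup-injective vs-unique (line-code-injective (adjacency l) (adjacency l′)
      (trans (≡.sym (Fin.splitAt-join t s _)) (trans (cong (splitAt t) e) (Fin.splitAt-join t s _))))

transpose : ∀ {t s} → Embedding (K s □ K t) (K t □ K s)
transpose = record { embed = Product.swap ; injective = cong Product.swap ; adjacent = Sum.swap }

module _ {k : ℕ} where

  next : Fin (suc k) → Fin (suc k)
  next i with Top.view i
  ... | Top.‵fromℕ     = zero
  ... | Top.‵inject₁ j = suc j

  prev : Fin (suc k) → Fin (suc k)
  prev zero    = fromℕ k
  prev (suc j) = inject₁ j

  prev-next : ∀ i → prev (next i) ≡ i
  prev-next i with Top.view i
  ... | Top.‵fromℕ     = refl
  ... | Top.‵inject₁ _ = refl

  toℕ-next : ∀ i → toℕ (next i) ≡ suc (toℕ i) ⊎ (next i ≡ zero × toℕ i ≡ k)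
  toℕ-next i with Top.view i
  ... | Top.‵fromℕ     = inj₂ (refl , Fin.toℕ-fromℕ k)
  ... | Top.‵inject₁ j = inj₁ (cong suc (≡.sym (Fin.toℕ-inject₁ j)))

next≢ : ∀ {k} (i : Fin (2 + k)) → next i ≢ i
next≢ i e with toℕ-next i
... | inj₁ p       = ℕ.1+n≢n (trans (≡.sym p) (cong toℕ e))
... | inj₂ (p , q) = ℕ.0≢1+n (trans (cong toℕ (trans (≡.sym p) e)) q)

next²≢ : ∀ {k} (i : Fin (3 + k)) → next (next i) ≢ i
next²≢ i e with toℕ-next i | toℕ-next (next i)
... | inj₁ p       | inj₁ q       = ℕ.m+1+n≢n 1 (trans (≡.sym (trans q (cong suc p))) (cong toℕ e))
... | inj₁ p       | inj₂ (q , r) =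
  ℕ.0≢1+n (ℕ.suc-injective (trans (≡.sym (trans p (cong (suc ∘ toℕ) (trans (≡.sym e) q)))) r))
... | inj₂ (p , q) | inj₁ r       =
  ℕ.0≢1+n (ℕ.suc-injective (trans (≡.sym (trans r (cong (suc ∘ toℕ) p))) (trans (cong toℕ e) q)))
... | inj₂ (p , _) | inj₂ (_ , r) = ℕ.0≢1+n (trans (≡.sym (cong toℕ p)) r)

module RowAndColumn (t n : ℕ) where

  Cell : Set
  Cell = Fin (suc t) × Fin (4 + n)

  Index : Set
  Index = Fin t ⊎ Fin (4 + n)

  terminal : Index → Cell
  terminal (inj₁ a) = suc a , zero
  terminal (inj₂ b) = zero , b

  detour : Index → Index → List Cell
  detour (inj₁ a) (inj₂ (suc b)) = (suc a , suc (next b)) ∷ (suc a , suc b) ∷ []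
  detour _ _ = []

  route : Index → Index → List Cell
  route x y = terminal x ∷ detour x y ++ [ terminal y ]

  earlier : Fin (3 + n) → Fin (3 + n) → Fin (3 + n)
  earlier c c′ with c′ Fin.≟ next c
  ... | yes _ = c
  ... | no  _ = c′

  earlier-next : ∀ b → earlier b (next b) ≡ b
  earlier-next b with next b Fin.≟ next b
  ... | yes _ = refl
  ... | no ≢  = ⊥-elim (≢ refl)

  earlier-next⁻ : ∀ b → earlier (next b) b ≡ b
  earlier-next⁻ b with b Fin.≟ next (next b)
  ... | yes e = ⊥-elim (next²≢ b (≡.sym e))
  ... | no  _ = refl

  -- Every edge of route x y is labelled {x , y}; edges on no route get arbitrary labels.
  label : Cell → Cell → Index × Index
  label (zero , b)     (zero , b′)    = inj₂ b , inj₂ b′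
  label (zero , b)     (suc a , _)    = inj₁ a , inj₂ b
  label (suc a , _)    (zero , b)     = inj₁ a , inj₂ b
  label (suc a , zero) (suc a′ , zero) = inj₁ a , inj₁ a′
  label (suc a , zero) (suc _ , suc c) = inj₁ a , inj₂ (suc (prev c))
  label (suc a , suc c) (suc _ , zero) = inj₁ a , inj₂ (suc (prev c))
  label (suc a , suc c) (suc _ , suc c′) = inj₁ a , inj₂ (suc (earlier c c′))

  Ordered : Index → Index → Set
  Ordered _        (inj₂ _) = ⊤
  Ordered (inj₁ _) (inj₁ _) = ⊤
  Ordered (inj₂ _) (inj₁ _) = ⊥

  record ValidRoute (x y : Index) : Set where
    field
      unique   : Unique (route x y)
      linked   : Consecutive (Adj (K (suc t) □ K (4 + n))) (route x y)
      odd      : (length (route x y) ∸ 1) % 2 ≡ 1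
      internal : All (λ v → ∀ z → v ≢ terminal z) (detour x y)
      labelled : ∀ {u v} → Step u v (route x y) → label u v ≐ (x , y) × label v u ≐ (x , y)

  valid-route : ∀ x y → x ≢ y → Ordered x y → ValidRoute x y
  valid-route (inj₁ a) (inj₁ a′) x≢y _ = record
    { unique   = (a≢a′ ∘ cong proj₁ ∷ []) ∷ [] ∷ []
    ; linked   = inj₂ (refl , a≢a′) , _
    ; odd      = refl
    ; internal = []
    ; labelled = λ { here → inj₁ refl , inj₂ refl ; (there (there ())) }
    }
    where
    a≢a′ : Fin.suc {t} a ≢ suc a′
    a≢a′ = x≢y ∘ cong inj₁ ∘ Fin.suc-injective
  valid-route (inj₂ b) (inj₂ b′) x≢y _ = record
    { unique   = (x≢y ∘ cong inj₂ ∘ cong proj₂ ∷ []) ∷ [] ∷ []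
    ; linked   = inj₁ (refl , x≢y ∘ cong inj₂) , _
    ; odd      = refl
    ; internal = []
    ; labelled = λ { here → inj₁ refl , inj₂ refl ; (there (there ())) }
    }
  valid-route (inj₁ a) (inj₂ zero) _ _ = record
    { unique   = ((λ ()) ∷ []) ∷ [] ∷ []
    ; linked   = inj₂ (refl , λ ()) , _
    ; odd      = refl
    ; internal = []
    ; labelled = λ { here → inj₁ refl , inj₁ refl ; (there (there ())) }
    }
  valid-route (inj₁ a) (inj₂ (suc b)) _ _ = record
    { unique   = ((λ ()) ∷ (λ ()) ∷ (λ ()) ∷ []) ∷ ((shifted ∘ cong proj₂) ∷ (λ ()) ∷ []) ∷ ((λ ()) ∷ []) ∷ []
                 ∷ []
    ; linked   = inj₁ (refl , λ ()) , inj₁ (refl , shifted) , inj₂ (refl , λ ()) , _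
    ; odd      = refl
    ; internal = off-lines ∷ off-lines ∷ []
    ; labelled = λ { here → inj₁ (pair (prev-next b)) , inj₁ (pair (prev-next b))
                   ; (there here) → inj₁ (pair (earlier-next⁻ b)) , inj₁ (pair (earlier-next b))
                   ; (there (there here)) → inj₁ refl , inj₁ refl
                   ; (there (there (there (there ())))) }
    }
    where
    shifted : Fin.suc {3 + n} (next b) ≢ suc b
    shifted = next≢ b ∘ Fin.suc-injective
    off-lines : ∀ {c} z → (suc a , suc c) ≢ terminal z
    off-lines (inj₁ _) ()
    off-lines (inj₂ _) ()
    pair : ∀ {c} → c ≡ b → (inj₁ a , inj₂ (suc c)) ≡ (inj₁ a , inj₂ (suc b))
    pair = cong (λ c → inj₁ a , inj₂ (suc c))
  valid-route (inj₂ _) (inj₁ _) _ ()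

  index : Fin (t + (4 + n)) → Index
  index = splitAt t

  index-injective : Injective _≡_ _≡_ index
  index-injective {i} {j} e =
    trans (≡.sym (Fin.join-splitAt t _ i)) (trans (cong (join t _) e) (Fin.join-splitAt t _ j))

  index-ordered : ∀ {i j} → i Fin.< j → Ordered (splitAt t i) (splitAt t j)
  index-ordered {i} {j} i<j with toℕ j ℕ.<? t
  ... | yes j<t rewrite Fin.splitAt-< t i (ℕ.<-trans i<j j<t) | Fin.splitAt-< t j j<t = _
  ... | no  j≮t rewrite Fin.splitAt-≥ t j (ℕ.≮⇒≥ j≮t) = _

  terminal-injective : Injective _≡_ _≡_ terminal
  terminal-injective {inj₁ _} {inj₁ _} refl = refl
  terminal-injective {inj₂ _} {inj₂ _} refl = refl

  immersion : TOImmersion (K (suc t) □ K (4 + n)) (t + (4 + n))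
  immersion = record
    { term     = terminal ∘ index
    ; term-inj = index-injective ∘ terminal-injective
    ; interior = λ i j → detour (index i) (index j)
    ; isPath   = λ i j i<j → ValidRoute.unique (valid i<j) , ValidRoute.linked (valid i<j)
    ; odd      = λ i j i<j → ValidRoute.odd (valid i<j)
    ; noTerm   = λ i j i<j → All.map (λ ≢terminal → ≢terminal ∘ index) (ValidRoute.internal (valid i<j))
    ; disjoint = λ i j k l i<j k<l ≢ → labelled-disjoint label
                   (ValidRoute.labelled (valid i<j)) (ValidRoute.labelled (valid k<l)) (distinct i<j k<l ≢)
    }
    where
    valid : ∀ {i j} → i Fin.< j → ValidRoute (index i) (index j)
    valid i<j = valid-route _ _ (λ e → Fin.<-irrefl (index-injective e) i<j) (index-ordered i<j)
    distinct : ∀ {i j k l} → i Fin.< j → k Fin.< l → ¬ (i ≡ k × j ≡ l) →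
               ¬ (index i , index j) ≐ (index k , index l)
    distinct _ _ ≢ (inj₁ e) = ≢ (index-injective (cong proj₁ e) , index-injective (cong proj₂ e))
    distinct i<j k<l _ (inj₂ e) = Fin.<-asym i<j
      (subst₂ Fin._<_ (≡.sym (index-injective (cong proj₂ e))) (≡.sym (index-injective (cong proj₁ e))) k<l)

rook-immersion-columns : ∀ {t s} → 1 ≤ t → 4 ≤ s → TOImmersion (K t □ K s) (t + s ∸ 1)
rook-immersion-columns {suc t} {suc (suc (suc (suc n)))} (s≤s _) (s≤s (s≤s (s≤s (s≤s _)))) =
  RowAndColumn.immersion t n

rook-immersion-rows : ∀ {t s} → 4 ≤ t → 1 ≤ s → TOImmersion (K t □ K s) (t + s ∸ 1)
rook-immersion-rows {t} {s} 4≤t 1≤s = subst (TOImmersion (K t □ K s)) (cong (_∸ 1) (ℕ.+-comm s t))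
                                        (transport transpose (rook-immersion-columns 1≤s 4≤t))

rook-immersion : ∀ {t s} → 2 ≤ t → 2 ≤ s → 4 ≤ t ⊔ s → TOImmersion (K t □ K s) (t + s ∸ 1)
rook-immersion {t} {s} 2≤t 2≤s 4≤t⊔s with ℕ.⊔-sel t s
... | inj₁ t⊔s≡t = rook-immersion-rows (subst (4 ≤_) t⊔s≡t 4≤t⊔s) (ℕ.<⇒≤ 2≤s)
... | inj₂ t⊔s≡s = rook-immersion-columns (ℕ.<⇒≤ 2≤t) (subst (4 ≤_) t⊔s≡s 4≤t⊔s)

rook-immersion-size : ∀ {t s m} → 1 ≤ t → 1 ≤ s → TOImmersion (K t □ K s) m → m ≤ t + s ∸ 1
rook-immersion-size {suc t} {suc s} {m} _ _ Im =
  subst (m ≤_) (≡.sym (ℕ.+-suc t s)) (immersion-size rook-degree Im)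

consecutive? : ∀ {A : Set} {R : A → A → Set} → (∀ a b → Dec (R a b)) → ∀ xs → Dec (Consecutive R xs)
consecutive? R? [] = yes _
consecutive? R? (x ∷ []) = yes _
consecutive? R? (x ∷ y ∷ xs) = R? x y ×-dec consecutive? R? (y ∷ xs)

module Decided {t s r : ℕ} (term : Fin r → Fin t × Fin s) (interior : Fin r → Fin r → List (Fin t × Fin s)) where
  open import Data.List.Relation.Unary.Unique.DecPropositional (_≟ᵛ_ {t} {s}) using (unique?)
  open import Data.List.Membership.DecPropositional (≡-dec (_≟ᵛ_ {t} {s}) (_≟ᵛ_ {t} {s})) using (_∈?_)

  path : Fin r → Fin r → List (Fin t × Fin s)
  path i j = term i ∷ interior i j ++ [ term j ]

  Conditions : Set
  Conditions = (∀ i j → term i ≡ term j → i ≡ j)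
             × (∀ i j → i Fin.< j → Unique (path i j) × Consecutive (Adj (K t □ K s)) (path i j))
             × (∀ i j → i Fin.< j → (length (path i j) ∸ 1) % 2 ≡ 1)
             × (∀ i j → i Fin.< j → All (λ v → ∀ k → v ≢ term k) (interior i j))
             × (∀ i j k l → i Fin.< j → k Fin.< l → ¬ (i ≡ k × j ≡ l) →
                  All (λ e → e ∉ steps (path k l) × Product.swap e ∉ steps (path k l)) (steps (path i j)))

  conditions? : Dec Conditions
  conditions? =
          (Fin.all? λ i → Fin.all? λ j → (term i ≟ᵛ term j) →-dec (i Fin.≟ j))
    ×-dec (Fin.all? λ i → Fin.all? λ j → (i Fin.<? j) →-dec
             (unique? (path i j) ×-dec consecutive? (adjacent? {t} {s}) (path i j)))
    ×-dec (Fin.all? λ i → Fin.all? λ j → (i Fin.<? j) →-dec ((length (path i j) ∸ 1) % 2 ℕ.≟ 1))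
    ×-dec (Fin.all? λ i → Fin.all? λ j → (i Fin.<? j) →-dec
             All.all? (λ v → Fin.all? λ k → ¬? (v ≟ᵛ term k)) (interior i j))
    ×-dec (Fin.all? λ i → Fin.all? λ j → Fin.all? λ k → Fin.all? λ l →
             (i Fin.<? j) →-dec ((k Fin.<? l) →-dec (¬? (i Fin.≟ k ×-dec j Fin.≟ l) →-dec
               All.all? (λ e → ¬? (e ∈? steps (path k l)) ×-dec ¬? (Product.swap e ∈? steps (path k l)))
                        (steps (path i j)))))

  immersion : True conditions? → TOImmersion (K t □ K s) r
  immersion ok = record
    { term     = term
    ; term-inj = λ {i} {j} → injective i j
    ; interior = interior
    ; isPath   = paths
    ; odd      = odd
    ; noTerm   = internal
    ; disjoint = λ i j k l i<j k<l ≢ _ _ → All.lookup (disjoint i j k l i<j k<l ≢)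
    }
    where
    injective = proj₁ (toWitness ok)
    paths     = proj₁ (proj₂ (toWitness ok))
    odd       = proj₁ (proj₂ (proj₂ (toWitness ok)))
    internal  = proj₁ (proj₂ (proj₂ (proj₂ (toWitness ok))))
    disjoint  = proj₂ (proj₂ (proj₂ (proj₂ (toWitness ok))))

K4-in-K3□K3 : TOImmersion (K 3 □ K 3) 4
K4-in-K3□K3 = Decided.immersion terminals interiors _
  where
  terminals : Fin 4 → Fin 3 × Fin 3
  terminals 0F = 0F , 0F
  terminals 1F = 0F , 1F
  terminals 2F = 0F , 2F
  terminals 3F = 1F , 0F
  interiors : Fin 4 → Fin 4 → List (Fin 3 × Fin 3)
  interiors 1F 3F = (1F , 1F) ∷ (1F , 2F) ∷ []
  interiors 2F 3F = (2F , 2F) ∷ (2F , 0F) ∷ []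
  interiors _  _  = []

K3-in-K2□K3 : TOImmersion (K 2 □ K 3) 3
K3-in-K2□K3 = Decided.immersion (0F ,_) (λ _ _ → []) _

module _ {t s : ℕ} where

  neighbour-in? : ∀ S w v → Dec (Adj (K t □ K s) w v × v ∈ S)
  neighbour-in? S w v = adjacent? w v ×-dec member? _≟ᵛ_ v S

  Crowded : ℕ → List (Fin t × Fin s) → Set
  Crowded k S = Any (λ w → w ∉ S × k ≤ length (filter (neighbour-in? S w) vertices)) vertices

  crowded? : ∀ k S → Dec (Crowded k S)
  crowded? k S =
    Any.any? (λ w → ¬? (member? _≟ᵛ_ w S) ×-dec k ℕ.≤? length (filter (neighbour-in? S w) vertices)) vertices

  OnCross : Fin t × Fin s → Fin t × Fin s → Set
  OnCross (c₁ , c₂) (a , b) = a ≡ c₁ ⊎ b ≡ c₂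

  IsCross : Fin t × Fin s → List (Fin t × Fin s) → Set
  IsCross c S = All (λ v → (v ∈ S → OnCross c v) × (OnCross c v → v ∈ S)) vertices

  is-cross? : ∀ c S → Dec (IsCross c S)
  is-cross? (c₁ , c₂) S =
    All.all? (λ v → (member? _≟ᵛ_ v S →-dec on? v) ×-dec (on? v →-dec member? _≟ᵛ_ v S)) vertices
    where
    on? : ∀ v → Dec (OnCross (c₁ , c₂) v)
    on? (a , b) = a Fin.≟ c₁ ⊎-dec b Fin.≟ c₂

K2□K3-4-subsets-crowded : All (λ S → length S ≡ 4 → Crowded 2 S) (sublists (vertices {2} {3}))
K2□K3-4-subsets-crowded = from-yes (All.all? (λ S → length S ℕ.≟ 4 →-dec crowded? 2 S) (sublists (vertices {2} {3})))

K3□K3-5-subsets-crowded-or-cross :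
  All (λ S → length S ≡ 5 → Crowded 3 S ⊎ Any (λ c → IsCross c S) vertices) (sublists (vertices {3} {3}))
K3□K3-5-subsets-crowded-or-cross = from-yes (All.all?
  (λ S → length S ℕ.≟ 5 →-dec (crowded? 3 S ⊎-dec Any.any? (λ c → is-cross? c S) vertices))
  (sublists (vertices {3} {3})))

module SaturatedRook {t s : ℕ} (Im : TOImmersion (K (suc t) □ K (suc s)) (suc (t + s))) where
  open Saturated _≟ᵛ_ rook-degree Im public

  terminal? : ∀ v → Dec (IsTerminal v)
  terminal? v = Fin.any? (λ k → term k ≟ᵛ v)

  terminals : List (Fin (suc t) × Fin (suc s))
  terminals = filter terminal? vertices

  terminals-count : length terminals ≡ suc (t + s)
  terminals-count = length-filter-image _≟ᵛ_ term term-inj vertices-unique ∈-vertices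

  terminals∈sublists : terminals ∈ sublists vertices
  terminals∈sublists = filter∈sublists terminal? vertices

  ∈-terminals⁻ : ∀ {v} → v ∈ terminals → IsTerminal v
  ∈-terminals⁻ = proj₂ ∘ ∈.∈-filter⁻ terminal?

  ∈-terminals⁺ : ∀ {v} → IsTerminal v → v ∈ terminals
  ∈-terminals⁺ = ∈.∈-filter⁺ terminal? (∈-vertices _)

  crowded-bound : ∀ {k} → Crowded k terminals → k + k ≤ t + s
  crowded-bound {k} crowded with Any.satisfied crowded
  ... | w , w∉ , k≤ = ℕ.≤-trans (ℕ.+-mono-≤ k≤ k≤) (twice-terminal-neighbours-≤-degree w-nonterminal
                        (Unique.filter⁺ (neighbour-in? terminals w) vertices-unique)
                        (All.map (Product.map₂ ∈-terminals⁻) (Allₚ.all-filter (neighbour-in? terminals w) vertices)))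
    where
    w-nonterminal : NonTerminal w
    w-nonterminal k w≡ = w∉ (∈-terminals⁺ (k , ≡.sym w≡))

no-K4-in-K2□K3 : ¬ TOImmersion (K 2 □ K 3) 4
no-K4-in-K2□K3 Im =
  from-no (2 + 2 ℕ.≤? 3) (crowded-bound (All.lookup K2□K3-4-subsets-crowded terminals∈sublists terminals-count))
  where open SaturatedRook Im

≢⇒opposite : ∀ {b b′ : Fin 2} → b ≢ b′ → b′ ≡ opposite b
≢⇒opposite {0F} {0F} b≢b′ = ⊥-elim (b≢b′ refl)
≢⇒opposite {0F} {1F} _    = refl
≢⇒opposite {1F} {0F} _    = refl
≢⇒opposite {1F} {1F} b≢b′ = ⊥-elim (b≢b′ refl)

module FiveTerminalsInK3□K3 (Im : TOImmersion (K 3 □ K 3) 5) where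
  open SaturatedRook Im

  module Cross (c₁ c₂ : Fin 3) (cross : IsCross (c₁ , c₂) terminals) where

    cross-terminal : ∀ v → OnCross (c₁ , c₂) v → IsTerminal v
    cross-terminal v on = ∈-terminals⁻ (proj₂ (All.lookup cross (∈-vertices v)) on)

    terminal-on-cross : ∀ k → OnCross (c₁ , c₂) (term k)
    terminal-on-cross k = proj₁ (All.lookup cross (∈-vertices (term k))) (∈-terminals⁺ (k , refl))

    block : Fin 2 → Fin 2 → Fin 3 × Fin 3
    block a b = punchIn c₁ a , punchIn c₂ b

    block-nonterminal : ∀ a b → NonTerminal (block a b)
    block-nonterminal a b k e with terminal-on-cross k
    ... | inj₁ on-row    = Fin.punchInᵢ≢i c₁ a (trans (cong proj₁ e) on-row)
    ... | inj₂ on-column = Fin.punchInᵢ≢i c₂ b (trans (cong proj₂ e) on-column)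

    nonterminal-off-cross : ∀ {y} → NonTerminal y → ¬ OnCross (c₁ , c₂) y
    nonterminal-off-cross y-nonterminal on = let (k , e) = cross-terminal _ on in y-nonterminal k (≡.sym e)

    off-cross : ∀ {y} → NonTerminal y → ∃₂ λ a b → y ≡ block a b
    off-cross {y₁ , y₂} y-nonterminal with y₁ Fin.≟ c₁ | y₂ Fin.≟ c₂
    ... | yes on-row | _             = ⊥-elim (nonterminal-off-cross y-nonterminal (inj₁ on-row))
    ... | no _       | yes on-column = ⊥-elim (nonterminal-off-cross y-nonterminal (inj₂ on-column))
    ... | no y₁≢c₁   | no y₂≢c₂      = punchOut (y₁≢c₁ ∘ ≡.sym) , punchOut (y₂≢c₂ ∘ ≡.sym) ,
                                        ≡.sym (cong₂ _,_ (Fin.punchIn-punchOut _) (Fin.punchIn-punchOut _))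

    block-neighbour : ∀ {a b y} → Adj (K 3 □ K 3) (block a b) y → NonTerminal y →
                      y ≡ block a (opposite b) ⊎ y ≡ block (opposite a) b
    block-neighbour adj y-nonterminal with off-cross y-nonterminal
    ... | a′ , b′ , refl with adj
    ...   | inj₁ (same-row , b≢b′) = inj₁ (cong₂ block (≡.sym (Fin.punchIn-injective c₁ _ _ same-row))
                                                        (≢⇒opposite (b≢b′ ∘ cong (punchIn c₂))))
    ...   | inj₂ (same-column , a≢a′) = inj₂ (cong₂ block (≢⇒opposite (a≢a′ ∘ cong (punchIn c₁)))
                                                           (≡.sym (Fin.punchIn-injective c₂ _ _ same-column)))

    opaque
      row col : Fin 2 → Fin 5
      row a = proj₁ (cross-terminal (punchIn c₁ a , c₂) (inj₂ refl))
      col b = proj₁ (cross-terminal (c₁ , punchIn c₂ b) (inj₁ refl))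

      term-row : ∀ a → term (row a) ≡ (punchIn c₁ a , c₂)
      term-row a = proj₂ (cross-terminal (punchIn c₁ a , c₂) (inj₂ refl))

      term-col : ∀ b → term (col b) ≡ (c₁ , punchIn c₂ b)
      term-col b = proj₂ (cross-terminal (c₁ , punchIn c₂ b) (inj₁ refl))

    row-adjacent : ∀ a b → Adj (K 3 □ K 3) (term (row a)) (block a b)
    row-adjacent a b = subst (λ v → Adj (K 3 □ K 3) v (block a b)) (≡.sym (term-row a)) (inj₁ (refl , ≢punchIn c₂ b))

    col-adjacent : ∀ a b → Adj (K 3 □ K 3) (term (col b)) (block a b)
    col-adjacent a b = subst (λ v → Adj (K 3 □ K 3) v (block a b)) (≡.sym (term-col b)) (inj₂ (refl , ≢punchIn c₁ a))

    rows-adjacent : Adj (K 3 □ K 3) (term (row 0F)) (term (row 1F))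
    rows-adjacent = subst₂ (Adj (K 3 □ K 3)) (≡.sym (term-row 0F)) (≡.sym (term-row 1F))
                      (inj₂ (refl , (λ ()) ∘ Fin.punchIn-injective c₁ 0F 1F))

    cols-adjacent : Adj (K 3 □ K 3) (term (col 0F)) (term (col 1F))
    cols-adjacent = subst₂ (Adj (K 3 □ K 3)) (≡.sym (term-col 0F)) (≡.sym (term-col 1F))
                      (inj₁ (refl , (λ ()) ∘ Fin.punchIn-injective c₂ 0F 1F))

    col≢row : ∀ {a b} → col b ≢ row a
    col≢row {a} {b} e =
      Fin.punchInᵢ≢i c₁ a (cong proj₁ (trans (≡.sym (term-row a)) (trans (cong term (≡.sym e)) (term-col b))))

    -- The walks from the two terminals next to a block vertex either both turn there or both go straight on.
    data Passage (a b : Fin 2) : Set where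
      turn     : Departs (col b) (block a b) (block a (opposite b)) →
                 Departs (row a) (block a b) (block (opposite a) b) → Passage a b
      straight : Departs (col b) (block a b) (block (opposite a) b) →
                 Departs (row a) (block a b) (block a (opposite b)) → Passage a b

    passage : ∀ a b → Passage a b
    passage a b with departs-through (col-adjacent a b) (block-nonterminal a b)
                   | departs-through (row-adjacent a b) (block-nonterminal a b)
    ... | _ , from-col , y-nonterminal | _ , from-row , z-nonterminal
      with block-neighbour (departs-adjacent from-col) y-nonterminal
         | block-neighbour (departs-adjacent from-row) z-nonterminal
    ... | inj₁ refl | inj₂ refl = turn from-col from-row
    ... | inj₂ refl | inj₁ refl = straight from-col from-row
    ... | inj₁ refl | inj₁ refl = ⊥-elim (col≢row (departs-unique from-col from-row))
    ... | inj₂ refl | inj₂ refl = ⊥-elim (col≢row (departs-unique from-col from-row))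

    block-0-0≢block-0-1 : block 0F 0F ≢ block 0F 1F
    block-0-0≢block-0-1 e with Fin.punchIn-injective c₂ 0F 1F (cong proj₂ e)
    ... | ()

    impossible : ⊥
    impossible = no-passages (passage 0F 0F) (passage 0F 1F) (passage 1F 0F) (passage 1F 1F)
      where
      no-passages : Passage 0F 0F → Passage 0F 1F → Passage 1F 0F → Passage 1F 1F → ⊥
      no-passages (turn c₀ _)     (turn c₁ _)      _                _                = no-detour c₀ c₁ cols-adjacent
      no-passages (turn _ r₀)     (straight _ _)   (turn _ r₁)      _                = no-detour r₀ r₁ rows-adjacent
      no-passages (turn c₀ r₀)    (straight _ r₀′) (straight c₀′ _) _                =
        block-0-0≢block-0-1 (List.∷-injectiveˡ (begin
          block 0F 0F ∷ block 1F 0F ∷ []      ≡⟨ proj₂ (departs-opposite r₀ c₀′) ⟨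
          between (row 0F) (col 0F)           ≡⟨ between-sym (proj₁ (departs-opposite c₀ r₀′)) ⟩
          reverse (between (col 0F) (row 0F)) ≡⟨ cong reverse (proj₂ (departs-opposite c₀ r₀′)) ⟩
          block 0F 1F ∷ block 0F 0F ∷ []      ∎))
        where open ≡.≡-Reasoning
      no-passages (straight _ r₀) (straight _ r₀′) _                _                = no-return r₀ r₀′
      no-passages (straight _ _)  (turn _ r₀′)     _                (turn _ r₁)      = no-detour r₀′ r₁ rows-adjacent
      no-passages (straight _ r₀) (turn c₁ r₀′)    _                (straight c₁′ _) =
        block-0-0≢block-0-1 (List.∷-injectiveˡ (begin
          block 0F 0F ∷ block 0F 1F ∷ []      ≡⟨ proj₂ (departs-opposite r₀ c₁) ⟨
          between (row 0F) (col 1F)           ≡⟨ proj₂ (departs-opposite r₀′ c₁′) ⟩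
          block 0F 1F ∷ block 1F 1F ∷ []      ∎))
        where open ≡.≡-Reasoning

  impossible : ⊥
  impossible = ruled-out (All.lookup K3□K3-5-subsets-crowded-or-cross terminals∈sublists terminals-count)
    where
    ruled-out : Crowded 3 terminals ⊎ Any (λ c → IsCross c terminals) vertices → ⊥
    ruled-out (inj₁ crowded) = from-no (3 + 3 ℕ.≤? 4) (crowded-bound crowded)
    ruled-out (inj₂ cross)   = let ((c₁ , c₂) , c-cross) = Any.satisfied cross in Cross.impossible c₁ c₂ c-cross

no-K5-in-K3□K3 : ¬ TOImmersion (K 3 □ K 3) 5
no-K5-in-K3□K3 = FiveTerminalsInK3□K3.impossible

toi≡-intro : ∀ {G n} → TOImmersion G n → (∀ {m} → TOImmersion G m → m ≤ suc n) → ¬ TOImmersion G (suc n) →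
             toi≡ G n
toi≡-intro Im bound none =
  Im , λ m Im′ → ℕ.≤-pred (ℕ.≤∧≢⇒< (bound Im′) (λ m≡ → none (subst (TOImmersion _) m≡ Im′)))

corollary12 : (∀ t s → 2 ≤ t → 2 ≤ s → 4 ≤ t ⊔ s → toi≡ (K t □ K s) (t + s ∸ 1))
    × toi≡ (K 3 □ K 3) 4
    × toi≡ (K 2 □ K 3) 3
corollary12 =
    (λ t s 2≤t 2≤s 4≤t⊔s → rook-immersion 2≤t 2≤s 4≤t⊔s , λ _ → rook-immersion-size (ℕ.<⇒≤ 2≤t) (ℕ.<⇒≤ 2≤s))
  , toi≡-intro K4-in-K3□K3 (rook-immersion-size (s≤s z≤n) (s≤s z≤n)) no-K5-in-K3□K3
  , toi≡-intro K3-in-K2□K3 (rook-immersion-size (s≤s z≤n) (s≤s z≤n)) no-K4-in-K2□K3
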